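{- Let $p,q$ be integers with $2<\frac{p}{q}<4$ and $p$ odd, let $\mu:G\times H\to K_{p/q}$ be a graph homomorphism, and let $h_0h_1$ be an oriented edge of $H$. Let $C$ be an odd-length closed walk in $G$. If $C$ has odd half-parity, then there is an edge $gg'$ of $C$ such that $\mu(g,h_0)\mu(g',h_0)$ and $\mu(g,h_1)\mu(g',h_1)$ are edges of $K_{p/q}$.
   Context: All graphs are finite, simple, loopless. $K_{p/q}$ has vertex set $\mathbb{Z}_p$ and edges $\{i,i+j\}$ for $j\in\{q,\dots,p-q\}$. $G\times H$ is the tensor product (vertices $V(G)\times V(H)$, $(g,h)(g',h')$ an edge iff $gg'\in E(G)$ and $hh'\in E(H)$). For a closed walk $C$ in $G$ from $g$, $C\times h_0h_1$ is the closed walk in $G\times H$ from $(g,h_0)$ whose projection to $G$ is $CC$ and whose projection to $H$ is $h_0h_1\,h_1h_0$ repeated $|C|$ times. A square is a quadruple $v_1,\dots,v_4$ with $v_1v_2,v_2v_3,v_3v_4,v_4v_1$ edges; $\sim$ is the smallest equivalence relation on walks such that a walk is equivalent to the result of deleting any consecutive pair $e,e^{ -1}$ and $W\,v_1v_2\,v_2v_3\,W'\sim W\,v_1v_4\,v_4v_3\,W'$ for all walks $W,W'$ and squares; $[W]$ is the class, with $[W]\cdot[W']=[WW']$; equivalent walks have equal length parity. The closed walk $C$ has odd half-parity (with respect to $\mu$ and $h_0h_1$) if $[\mu(C\times h_0h_1)]=X\cdot X$ for some class $X$ of walks in $K_{p/q}$ of odd length. -}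

module Defs where

open import Data.Nat using (ℕ; zero; suc; _+_; _*_; _∸_; _≤_; _<_)
open import Data.Fin using (Fin; toℕ)
open import Data.List using (List; []; _∷_; _++_; length; map)
open import Data.Product using (Σ; ∃; ∃-syntax; _×_; _,_)
open import Data.Sum using (_⊎_)
open import Function.Bundles using (_↔_)
open import Relation.Nullary using (¬_)
open import Relation.Binary.PropositionalEquality using (_≡_)
open import Relation.Binary.Construct.Closure.Equivalence using (EqClosure)

record Graph : Set₁ where
  field
    V : Set
    E : V → V → Set
open Graph public

IsFiniteSimpleGraph : Graph → Set
IsFiniteSimpleGraph G =
  (∃[ n ] (V G ↔ Fin n)) ×
  (∀ {x y} → E G x y → E G y x) ×
  (∀ {x} → ¬ E G x x)

Hom : Graph → Graph → Set
Hom G K = Σ (V G → V K) λ f → ∀ {x y} → E G x y → E K (f x) (f y)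

_⊗_ : Graph → Graph → Graph
G ⊗ H = record
  { V = V G × V H
  ; E = λ { (g , h) (g' , h') → E G g g' × E H h h' } }

-- K_{p/q}: vertex set ℤ_p = Fin p, edges {i, i+j mod p} for j ∈ {q,…,p-q}.
-- Since 0 ≤ i < p and j ≤ p, (i + j) mod p = i' iff i + j = i' or i + j = i' + p.
K : ℕ → ℕ → Graph
K p q = record
  { V = Fin p
  ; E = λ i i' → ∃[ j ] (q ≤ j × j ≤ p ∸ q ×
          (toℕ i + j ≡ toℕ i' ⊎ toℕ i + j ≡ toℕ i' + p)) }

Odd : ℕ → Set
Odd n = ∃[ k ] n ≡ suc (2 * k)

-- Walks, represented by their vertex sequences v₀ v₁ … v_k.
-- 'IsWalk G v₀ vs' says v₀ ∷ vs is a walk (consecutive vertices adjacent);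
-- its length is 'length vs'.

data IsWalk (G : Graph) : V G → List (V G) → Set where
  nil  : ∀ {v} → IsWalk G v []
  cons : ∀ {v w ws} → E G v w → IsWalk G w ws → IsWalk G v (w ∷ ws)

lastV : {A : Set} → A → List A → A
lastV v []       = v
lastV v (w ∷ ws) = lastV w ws

IsClosedWalk : (G : Graph) → V G → List (V G) → Set
IsClosedWalk G v vs = IsWalk G v vs × lastV v vs ≡ v

IsStepOf : {A : Set} → A → A → List A → Set
IsStepOf g g' vs = ∃[ xs ] ∃[ ys ] (vs ≡ xs ++ (g ∷ g' ∷ ys))

IsSquare : (G : Graph) → V G → V G → V G → V G → Set
IsSquare G v₁ v₂ v₃ v₄ = E G v₁ v₂ × E G v₂ v₃ × E G v₃ v₄ × E G v₄ v₁

data Move (G : Graph) : List (V G) → List (V G) → Set where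
  -- delete a consecutive pair e e⁻¹, e = ab
  cancel : ∀ xs ys a b → E G a b →
           Move G (xs ++ (a ∷ b ∷ a ∷ ys)) (xs ++ (a ∷ ys))
  square : ∀ xs ys v₁ v₂ v₃ v₄ → IsSquare G v₁ v₂ v₃ v₄ →
           Move G (xs ++ (v₁ ∷ v₂ ∷ v₃ ∷ ys)) (xs ++ (v₁ ∷ v₄ ∷ v₃ ∷ ys))

WalkEquiv : (G : Graph) → List (V G) → List (V G) → Set
WalkEquiv G W W' = EqClosure (Move G) W W'

altZip : {A B : Set} → List A → B → B → List (A × B)
altZip []       a b = []
altZip (x ∷ xs) a b = (x , a) ∷ altZip xs b a

-- vertex sequence of C × h₀h₁ for the closed walk C = g ∷ cs:
-- G-projection is CC = g ∷ cs ++ cs, H-projection is h₀ h₁ h₀ h₁ … h₀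
prodWalk : (G H : Graph) → V G → List (V G) → V H → V H → List (V G × V H)
prodWalk G H g cs h₀ h₁ = (g , h₀) ∷ altZip (cs ++ cs) h₁ h₀

-- C has odd half-parity w.r.t. μ and h₀h₁:
-- [μ(C × h₀h₁)] = X·X with X = [W] for a walk W = w ∷ ws of odd length;
-- X·X = [WW] is defined only when W is closed, and WW = w ∷ ws ++ ws.
OddHalfParity : (G H : Graph) (p q : ℕ) → Hom (G ⊗ H) (K p q) →
                V H → V H → V G → List (V G) → Set
OddHalfParity G H p q (μ , _) h₀ h₁ g cs =
  ∃[ w ] ∃[ ws ] (IsClosedWalk (K p q) w ws × Odd (length ws) ×
    WalkEquiv (K p q) (map μ (prodWalk G H g cs h₀ h₁)) (w ∷ ws ++ ws))

-- For vertices i, j of K_{p/q} let δ i j ∈ [0,p) be the displacement j − i (mod p);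
-- ij is an edge iff q ≤ δ i j ≤ p − q.  The winding of a walk is the sum of the
-- displacements of its steps.  A back-and-forth step winds exactly p, and, because
-- p/q < 4, both halves of a square wind equally; so 2·winding − p·length is invariant
-- under ∼ (∼-balanced).  Next, a local analysis of the two crossing product edges
-- (x,h₀)(y,h₁) and (x,h₁)(y,h₀) shows that at a step xy which is not good their
-- displacements X, Y satisfy X + p = e x + Y + e y, where e x is the displacement of the
-- rung μ(x,h₀)μ(x,h₁) (crossing).  Summing along a walk without good steps shows that
-- winding(μ(C × h₀h₁)) + |C|·p is even (ladder-even), while odd half-parity and the
-- invariant give winding(μ(C × h₀h₁)) + p·|W| = 2·winding(W) + p·|C| with p and |W| odd.
-- These parities clash (parity-clash); since good steps are decidable, one exists.
module Submission where

open import Defs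
open import Data.Nat using (ℕ; _*_; _<_)
open import Data.List using (List; _∷_; length)
open import Data.Product using (Σ; ∃-syntax; _×_; _,_; proj₁)
open import Data.Nat
open import Data.Nat.Properties
open import Data.Nat.DivMod
open import Data.Nat.Tactic.RingSolver using (solve; solve-∀)
open import Data.Fin using (Fin; toℕ)
open import Data.Fin.Properties using (toℕ<n)
open import Data.List using ([]; _++_; map)
open import Data.List.Properties using (length-++; length-map)
open import Data.Product using (proj₂; swap)
open import Data.Sum using (_⊎_; inj₁; inj₂)
import Data.Sum as Sum
open import Data.Empty using (⊥; ⊥-elim)
open import Relation.Nullary using (¬_; Dec; yes; no)
open import Relation.Nullary.Decidable using (map′; _×-dec_)
open import Relation.Binary.PropositionalEquality
open import Relation.Binary.Construct.Closure.ReflexiveTransitive using (ε; _◅_)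
open import Relation.Binary.Construct.Closure.Symmetric using (fwd; bwd)

smaller-summand : ∀ {a b c p} → a + c ≡ b + p → c < p → b < a
smaller-summand {a} {b} {c} {p} eq c<p = +-cancelʳ-< p b a (begin-strict
  b + p ≡⟨ eq ⟨
  a + c <⟨ +-monoʳ-< a c<p ⟩
  a + p ∎)
  where open ≤-Reasoning

squeeze : ∀ {p k m} → k * p < m * p → m * p < (2 + k) * p → m ≡ suc k
squeeze {p} {k} {m} lo hi =
  ≤-antisym (≤-pred (*-cancelʳ-< p m (2 + k) hi)) (*-cancelʳ-< p k m lo)

quadruple : ∀ n → 4 * n ≡ n + (n + (n + n))
quadruple = solve-∀

-- If r + q < 4q then 4r < 3(r + q); with r = p − q: four edges of K_{p/q} wind < 3p.
four-short-edges : ∀ r q → r + q < 4 * q → 4 * r < 3 * (r + q)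
four-short-edges r q r+q<4q = begin-strict
  4 * r        ≡⟨ solve (r ∷ []) ⟩
  3 * r + r    <⟨ +-monoʳ-< (3 * r) r<3q ⟩
  3 * r + 3 * q ≡⟨ solve (r ∷ q ∷ []) ⟩
  3 * (r + q)  ∎
  where
  open ≤-Reasoning
  four-q : 4 * q ≡ 3 * q + q
  four-q = solve (q ∷ [])
  r<3q : r < 3 * q
  r<3q = +-cancelʳ-< q r (3 * q) (subst (r + q <_) four-q r+q<4q)

-- transitivity of (a , b) ~ (c , d) ⇔ a + d = c + b, the relation presenting ℤ as differences
difference-trans : ∀ {a b c d e f} → a + d ≡ c + b → c + f ≡ e + d → a + f ≡ e + b
difference-trans {a} {b} {c} {d} {e} {f} h₁ h₂ = +-cancelʳ-≡ (c + d) (a + f) (e + b) (begin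
  a + f + (c + d)    ≡⟨ solve (a ∷ b ∷ c ∷ d ∷ e ∷ f ∷ []) ⟩
  (a + d) + (c + f)  ≡⟨ cong₂ _+_ h₁ h₂ ⟩
  (c + b) + (e + d)  ≡⟨ solve (a ∷ b ∷ c ∷ d ∷ e ∷ f ∷ []) ⟩
  e + b + (c + d)    ∎)
  where open ≡-Reasoning

odd*odd : ∀ {m n} → Odd m → Odd n → Odd (m * n)
odd*odd (a , refl) (b , refl) = a + b + 2 * a * b , expand a b
  where
  expand : ∀ a b → suc (2 * a) * suc (2 * b) ≡ suc (2 * (a + b + 2 * a * b))
  expand = solve-∀

-- The final parity count: if T + N·p is even (up to 2e) while T + p·M = 2R + p·N,
-- then p·M is even, which is impossible for odd p and M.
parity-clash : ∀ {p M T N e R} → Odd p → Odd M →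
  (∃[ S ] T + N * p + e + e ≡ 2 * S) → T + p * M ≡ R + R + p * N → ⊥
parity-clash {p} {M} {T} {N} {e} {R} odd-p odd-M (S , even) balance with odd*odd odd-p odd-M
... | w , pM≡odd = even≢odd (R + p * N + e) (S + w) (begin
  2 * (R + p * N + e)                   ≡⟨ solve (p ∷ N ∷ e ∷ R ∷ []) ⟩
  R + R + p * N + N * p + e + e         ≡⟨ cong (λ t → t + N * p + e + e) balance ⟨
  T + p * M + N * p + e + e             ≡⟨ solve (p ∷ M ∷ T ∷ N ∷ e ∷ []) ⟩
  T + N * p + e + e + p * M             ≡⟨ cong₂ _+_ even pM≡odd ⟩
  2 * S + suc (2 * w)                   ≡⟨ solve (S ∷ w ∷ []) ⟩
  suc (2 * (S + w))                     ∎)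
  where open ≡-Reasoning

halve-balance : ∀ {p a b m n} → 2 * a + p * suc (m + m) ≡ 2 * b + p * suc (n + n) →
  a + p * m ≡ b + p * n
halve-balance {p} {a} {b} {m} {n} eq = *-cancelˡ-≡ (a + p * m) (b + p * n) 2
  (+-cancelʳ-≡ p _ _ (begin
    2 * (a + p * m) + p    ≡⟨ solve (p ∷ a ∷ m ∷ []) ⟩
    2 * a + p * suc (m + m) ≡⟨ eq ⟩
    2 * b + p * suc (n + n) ≡⟨ solve (p ∷ b ∷ n ∷ []) ⟩
    2 * (b + p * n) + p    ∎))
  where open ≡-Reasoning

flipAlong : {A B : Set} → List A → B × B → B × B
flipAlong []       hh = hh
flipAlong (_ ∷ ys) hh = flipAlong ys (swap hh)

flipAlong-odd : ∀ {A B : Set} (ys : List A) (hh : B × B) {k} →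
  length ys ≡ suc (2 * k) → flipAlong ys hh ≡ swap hh
flipAlong-odd (_ ∷ [])     hh {zero}  refl = refl
flipAlong-odd (_ ∷ _ ∷ ys) hh {suc k} eq   =
  flipAlong-odd ys hh {k} (trans (suc-injective (suc-injective eq)) (+-suc k (k + 0)))

length-altZip : ∀ {A B : Set} (xs : List A) (a b : B) → length (altZip xs a b) ≡ length xs
length-altZip []       a b = refl
length-altZip (x ∷ xs) a b = cong suc (length-altZip xs b a)

-- Arithmetic modulo p: congruence, and walking forward around ℤ_p = Fin p.
module Modular (p : ℕ) .{{_ : NonZero p}} where

  infix 4 _≈_
  _≈_ : ℕ → ℕ → Set
  m ≈ n = m % p ≡ n % p

  +-congʳ-≈ : ∀ {m n} c → m ≈ n → m + c ≈ n + c
  +-congʳ-≈ {m} {n} c m≈n = begin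
    (m + c) % p          ≡⟨ %-distribˡ-+ m c p ⟩
    (m % p + c % p) % p  ≡⟨ cong (λ r → (r + c % p) % p) m≈n ⟩
    (n % p + c % p) % p  ≡⟨ %-distribˡ-+ n c p ⟨
    (n + c) % p          ∎
    where open ≡-Reasoning

  +-congˡ-≈ : ∀ {m n} c → m ≈ n → c + m ≈ c + n
  +-congˡ-≈ {m} {n} c m≈n =
    trans (cong (_% p) (+-comm c m)) (trans (+-congʳ-≈ c m≈n) (cong (_% p) (+-comm n c)))

  -- addition is cancellative modulo p: add c·p − c to undo adding c
  +-cancelˡ-≈ : ∀ c {m n} → c + m ≈ c + n → m ≈ n
  +-cancelˡ-≈ c {m} {n} c+m≈c+n = begin
    m % p                  ≡⟨ [m+kn]%n≡m%n m c p ⟨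
    (m + c * p) % p        ≡⟨ cong (_% p) (undo m) ⟨
    (c + m + c*p∸c) % p    ≡⟨ +-congʳ-≈ c*p∸c c+m≈c+n ⟩
    (c + n + c*p∸c) % p    ≡⟨ cong (_% p) (undo n) ⟩
    (n + c * p) % p        ≡⟨ [m+kn]%n≡m%n n c p ⟩
    n % p                  ∎
    where
    open ≡-Reasoning
    c*p∸c : ℕ
    c*p∸c = c * p ∸ c
    undo : ∀ k → c + k + c*p∸c ≡ k + c * p
    undo k = begin
      c + k + c*p∸c    ≡⟨ cong (_+ c*p∸c) (+-comm c k) ⟩
      k + c + c*p∸c    ≡⟨ +-assoc k c c*p∸c ⟩
      k + (c + c*p∸c)  ≡⟨ cong (k +_) (m+[n∸m]≡n (m≤m*n c p)) ⟩
      k + c * p        ∎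

  ≈⇒≡+multiple : ∀ {s x} → s ≈ x → x < p → s ≡ x + (s / p) * p
  ≈⇒≡+multiple {s} {x} s≈x x<p =
    trans (m≡m%n+[m/n]*n s p) (cong (_+ (s / p) * p) (trans s≈x (m<n⇒m%n≡m x<p)))

  ≈⇒≡ : ∀ {m n} → m ≈ n → m < p → n < p → m ≡ n
  ≈⇒≡ {m} {n} m≈n m<p n<p =
    trans (sym (m<n⇒m%n≡m m<p)) (trans m≈n (m<n⇒m%n≡m n<p))

  -- The arithmetic core of the crossing lemma below: if e + Y + f exceeds X by 0
  -- or by 2p, then the partial sum e + Y reduced mod p lies between X and Y.
  partial-sum-between : ∀ {e f X Y} → e < p → f < p →
    e + (Y + f) ≡ X ⊎ e + (Y + f) ≡ X + 2 * p →
    ∃[ u ] (u ≈ e + Y × ((X ≤ u × u ≤ Y) ⊎ (Y ≤ u × u ≤ X)))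
  partial-sum-between {e} {f} {X} {Y} e<p f<p (inj₁ s≡X) =
    e + Y , refl , inj₂ (m≤n+m Y e , e+Y≤X)
    where
    e+Y≤X : e + Y ≤ X
    e+Y≤X = ≤-trans (m≤m+n (e + Y) f) (≤-reflexive (trans (+-assoc e Y f) s≡X))
  partial-sum-between {e} {f} {X} {Y} e<p f<p (inj₂ s≡X+2p) =
    u , u≈e+Y , inj₁ (<⇒≤ X<u , <⇒≤ u<Y)
    where
    total : e + Y + f ≡ X + p + p
    total = trans (+-assoc e Y f) (trans s≡X+2p (solve (X ∷ p ∷ [])))
    X+p<e+Y : X + p < e + Y
    X+p<e+Y = smaller-summand total f<p
    u : ℕ
    u = e + Y ∸ p
    u+p≡e+Y : u + p ≡ e + Y
    u+p≡e+Y = m∸n+n≡m (≤-trans (m≤n+m p X) (<⇒≤ X+p<e+Y))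
    u≈e+Y : u ≈ e + Y
    u≈e+Y = trans (sym ([m+n]%n≡m%n u p)) (cong (_% p) u+p≡e+Y)
    u<Y : u < Y
    u<Y = smaller-summand (trans (+-comm Y e) (sym u+p≡e+Y)) e<p
    X<u : X < u
    X<u = smaller-summand (+-cancelʳ-≡ p (u + f) (X + p) (begin
      u + f + p    ≡⟨ +-assoc u f p ⟩
      u + (f + p)  ≡⟨ cong (u +_) (+-comm f p) ⟩
      u + (p + f)  ≡⟨ +-assoc u p f ⟨
      u + p + f    ≡⟨ cong (_+ f) u+p≡e+Y ⟩
      e + Y + f    ≡⟨ total ⟩
      X + p + p    ∎)) f<p
      where open ≡-Reasoning

  infix 4 _⟶[_]_
  record _⟶[_]_ (i : Fin p) (s : ℕ) (j : Fin p) : Set where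
    constructor reach
    field lands : toℕ i + s ≈ toℕ j
  open _⟶[_]_ public

  ⟶-trans : ∀ {i j k s t} → i ⟶[ s ] j → j ⟶[ t ] k → i ⟶[ s + t ] k
  ⟶-trans {i} {s = s} {t} (reach i⟶j) (reach j⟶k) =
    reach (trans (cong (_% p) (sym (+-assoc (toℕ i) s t))) (trans (+-congʳ-≈ t i⟶j) j⟶k))

  ⟶-unique : ∀ {i j s t} → i ⟶[ s ] j → i ⟶[ t ] j → s ≈ t
  ⟶-unique {i} (reach i⟶j) (reach i⟶'j) = +-cancelˡ-≈ (toℕ i) (trans i⟶j (sym i⟶'j))

  ⟶-resp-≈ : ∀ {i j s u} → i ⟶[ s ] j → u ≈ s → i ⟶[ u ] j
  ⟶-resp-≈ {i} (reach i⟶j) u≈s = reach (trans (+-congˡ-≈ (toℕ i) u≈s) i⟶j)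

  ⟶-loop : ∀ {i s} → i ⟶[ s ] i → s ≡ (s / p) * p
  ⟶-loop {i} i⟶i =
    ≈⇒≡+multiple (⟶-unique i⟶i (reach (cong (_% p) (+-identityʳ (toℕ i))))) (>-nonZero⁻¹ p)

  -- the displacement from i to j: the unique s < p with i ⟶[ s ] j
  δ : Fin p → Fin p → ℕ
  δ i j = (toℕ j + (p ∸ toℕ i)) % p

  δ<p : ∀ i j → δ i j < p
  δ<p i j = m%n<n _ p

  δ-reaches : ∀ i j → i ⟶[ δ i j ] j
  δ-reaches i j = reach (trans (+-congˡ-≈ (toℕ i) (m%n%n≡m%n _ p))
    (trans (cong (_% p) around) ([m+n]%n≡m%n (toℕ j) p)))
    where
    around : toℕ i + (toℕ j + (p ∸ toℕ i)) ≡ toℕ j + p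
    around = begin
      toℕ i + (toℕ j + (p ∸ toℕ i))  ≡⟨ exchange (toℕ i) (toℕ j) (p ∸ toℕ i) ⟩
      toℕ j + (toℕ i + (p ∸ toℕ i))  ≡⟨ cong (toℕ j +_) (m+[n∸m]≡n (<⇒≤ (toℕ<n i))) ⟩
      toℕ j + p                      ∎
      where
      open ≡-Reasoning
      exchange : ∀ a b c → a + (b + c) ≡ b + (a + c)
      exchange = solve-∀

  δ-unique : ∀ {i j s} → i ⟶[ s ] j → s < p → δ i j ≡ s
  δ-unique {i} {j} i⟶j s<p = ≈⇒≡ (⟶-unique (δ-reaches i j) i⟶j) (δ<p i j) s<p

-- Facts about the circular clique K_{p/q} for 2 < p/q < 4.
module Circular (p q : ℕ) (2q<p : 2 * q < p) (p<4q : p < 4 * q) where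

  instance
    p≢0 : NonZero p
    p≢0 = >-nonZero (≤-<-trans z≤n 2q<p)

  open Modular p

  1≤q : 1 ≤ q
  1≤q = n≢0⇒n>0 (λ q≡0 → n≮0 (subst (λ r → p < 4 * r) q≡0 p<4q))

  q≤p : q ≤ p
  q≤p = ≤-trans (m≤m+n q (q + 0)) (<⇒≤ 2q<p)

  p∸q<p : p ∸ q < p
  p∸q<p = ∸-monoʳ-< {p} {q} {0} 1≤q q≤p

  EdgeLength : ℕ → Set
  EdgeLength s = q ≤ s × s ≤ p ∸ q

  Edge : Fin p → Fin p → Set
  Edge = E (K p q)

  edge⇒reach : ∀ {i j} → Edge i j → ∃[ s ] (i ⟶[ s ] j × EdgeLength s)
  edge⇒reach (s , q≤s , s≤p∸q , inj₁ i+s≡j) = s , reach (cong (_% p) i+s≡j) , q≤s , s≤p∸q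
  edge⇒reach {j = j} (s , q≤s , s≤p∸q , inj₂ i+s≡j+p) =
    s , reach (trans (cong (_% p) i+s≡j+p) ([m+n]%n≡m%n (toℕ j) p)) , q≤s , s≤p∸q

  reach⇒edge : ∀ {i j s} → i ⟶[ s ] j → EdgeLength s → Edge i j
  reach⇒edge {i} {j} {s} i⟶j (q≤s , s≤p∸q) = s , q≤s , s≤p∸q , wrap
    where
    t : ℕ
    t = toℕ i + s
    t≡j+kp : t ≡ toℕ j + (t / p) * p
    t≡j+kp = ≈⇒≡+multiple (lands i⟶j) (toℕ<n j)
    t<2p : t < 2 * p
    t<2p = subst (t <_) (cong (p +_) (sym (+-identityʳ p)))
             (+-mono-< (toℕ<n i) (≤-<-trans s≤p∸q p∸q<p))
    wrap : t ≡ toℕ j ⊎ t ≡ toℕ j + p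
    wrap with t / p | t≡j+kp | m<n*o⇒m/o<n {t} {2} {p} t<2p
    ... | 0           | eq | _ = inj₁ (trans eq (+-identityʳ (toℕ j)))
    ... | 1           | eq | _ = inj₂ (trans eq (cong (toℕ j +_) (+-identityʳ p)))
    ... | suc (suc _) | _  | s≤s (s≤s ())

  edge⇒δ : ∀ {i j} → Edge i j → EdgeLength (δ i j)
  edge⇒δ {i} {j} ij with edge⇒reach ij
  ... | s , i⟶j , len@(_ , s≤p∸q) =
    subst EdgeLength (sym (δ-unique i⟶j (≤-<-trans s≤p∸q p∸q<p))) len

  edge? : ∀ i j → Dec (Edge i j)
  edge? i j = map′ (reach⇒edge (δ-reaches i j)) edge⇒δ
    ((q ≤? δ i j) ×-dec (δ i j ≤? p ∸ q))

  loop-length : ∀ {i s} k → i ⟶[ s ] i → k * p < s → s < (2 + k) * p → s ≡ suc k * p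
  loop-length {i} {s} k i⟶i lo hi = begin
    s            ≡⟨ ⟶-loop i⟶i ⟩
    (s / p) * p  ≡⟨ cong (_* p) (squeeze {p} {k} {s / p}
                      (subst (k * p <_) (⟶-loop i⟶i) lo)
                      (subst (_< (2 + k) * p) (⟶-loop i⟶i) hi)) ⟩
    suc k * p    ∎
    where open ≡-Reasoning

  there-and-back : ∀ {a b} → Edge a b → δ a b + δ b a ≡ p
  there-and-back {a} {b} ab = begin
    δ a b + δ b a  ≡⟨ loop-length 0 (⟶-trans (δ-reaches a b) (δ-reaches b a)) lo hi ⟩
    1 * p          ≡⟨ *-identityˡ p ⟩
    p              ∎
    where
    open ≡-Reasoning
    lo : 0 < δ a b + δ b a
    lo = ≤-trans (≤-trans 1≤q (proj₁ (edge⇒δ ab))) (m≤m+n (δ a b) (δ b a))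
    hi : δ a b + δ b a < 2 * p
    hi = subst (δ a b + δ b a <_) (cong (p +_) (sym (+-identityʳ p)))
           (+-mono-< (δ<p a b) (δ<p b a))

  four-edges<3p : 4 * (p ∸ q) < 3 * p
  four-edges<3p = subst (4 * (p ∸ q) <_) (cong (3 *_) (m∸n+n≡m q≤p))
    (four-short-edges (p ∸ q) q (subst (_< 4 * q) (sym (m∸n+n≡m q≤p)) p<4q))

  -- Since 2 < p/q < 4 the displacements around a square sum to exactly 2p, so
  -- both halves of a square have the same displacement.
  square-winding : ∀ {v₁ v₂ v₃ v₄} → IsSquare (K p q) v₁ v₂ v₃ v₄ →
    δ v₁ v₂ + δ v₂ v₃ ≡ δ v₁ v₄ + δ v₄ v₃
  square-winding {v₁} {v₂} {v₃} {v₄} (e₁₂ , e₂₃ , e₃₄ , e₄₁) =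
    +-cancelʳ-≡ (δ v₃ v₄ + δ v₄ v₁) _ _ (begin
      δ v₁ v₂ + δ v₂ v₃ + (δ v₃ v₄ + δ v₄ v₁)    ≡⟨ +-assoc (δ v₁ v₂) (δ v₂ v₃) _ ⟩
      s                                          ≡⟨ loop-length 1 around lo hi ⟩
      2 * p                                      ≡⟨ cong₂ (λ a b → a + (b + 0))
                                                      (sym (there-and-back e₄₁))
                                                      (sym (there-and-back e₃₄)) ⟩
      δ v₄ v₁ + δ v₁ v₄ + (δ v₃ v₄ + δ v₄ v₃ + 0) ≡⟨ regroup (δ v₄ v₁) (δ v₁ v₄) (δ v₃ v₄) (δ v₄ v₃) ⟩
      δ v₁ v₄ + δ v₄ v₃ + (δ v₃ v₄ + δ v₄ v₁)    ∎)
    where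
    open ≡-Reasoning
    s : ℕ
    s = δ v₁ v₂ + (δ v₂ v₃ + (δ v₃ v₄ + δ v₄ v₁))
    around : v₁ ⟶[ s ] v₁
    around = ⟶-trans (δ-reaches v₁ v₂)
               (⟶-trans (δ-reaches v₂ v₃) (⟶-trans (δ-reaches v₃ v₄) (δ-reaches v₄ v₁)))
    regroup : ∀ a b c d → a + b + (c + d + 0) ≡ b + d + (c + a)
    regroup = solve-∀
    lower : ∀ {i j} → Edge i j → q ≤ δ i j
    lower e = proj₁ (edge⇒δ e)
    upper : ∀ {i j} → Edge i j → δ i j ≤ p ∸ q
    upper e = proj₂ (edge⇒δ e)
    lo : 1 * p < s
    lo = ≤-Reasoning.begin-strict
      1 * p              ≤-Reasoning.≡⟨ *-identityˡ p ⟩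
      p                  ≤-Reasoning.<⟨ p<4q ⟩
      4 * q              ≤-Reasoning.≡⟨ quadruple q ⟩
      q + (q + (q + q))  ≤-Reasoning.≤⟨ +-mono-≤ (lower e₁₂) (+-mono-≤ (lower e₂₃)
                                         (+-mono-≤ (lower e₃₄) (lower e₄₁))) ⟩
      s                  ≤-Reasoning.∎
    hi : s < 3 * p
    hi = ≤-<-trans (+-mono-≤ (upper e₁₂) (+-mono-≤ (upper e₂₃) (+-mono-≤ (upper e₃₄) (upper e₄₁))))
           (subst (_< 3 * p) (quadruple (p ∸ q)) four-edges<3p)

  between-edgeLength : ∀ {X Y u} → EdgeLength X → EdgeLength Y →
    (X ≤ u × u ≤ Y) ⊎ (Y ≤ u × u ≤ X) → EdgeLength u
  between-edgeLength (q≤X , _) (_ , Y≤p∸q) (inj₁ (X≤u , u≤Y)) = ≤-trans q≤X X≤u , ≤-trans u≤Y Y≤p∸q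
  between-edgeLength (_ , X≤p∸q) (q≤Y , _) (inj₂ (Y≤u , u≤X)) = ≤-trans q≤Y Y≤u , ≤-trans u≤X X≤p∸q

  detour-edge : ∀ {i j e f X Y} → i ⟶[ e + Y ] j → e < p → f < p →
    EdgeLength X → EdgeLength Y → e + (Y + f) ≡ X ⊎ e + (Y + f) ≡ X + 2 * p → Edge i j
  detour-edge i⟶j e<p f<p lenX lenY sums with partial-sum-between e<p f<p sums
  ... | u , u≈e+Y , between =
    reach⇒edge (⟶-resp-≈ i⟶j u≈e+Y) (between-edgeLength lenX lenY between)

  -- For crossing edges a₀b₁ and b₀a₁ (the images of (x,h₀)(y,h₁) and
  -- (x,h₁)(y,h₀)), either a₀a₁ and b₀b₁ are both edges, or the path a₀ → b₀ → a₁ → b₁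
  -- winds exactly once more around ℤ_p than the edge a₀ → b₁.
  crossing : ∀ {a₀ b₀ a₁ b₁} → Edge a₀ b₁ → Edge b₀ a₁ →
    δ a₀ b₁ + p ≡ δ a₀ b₀ + (δ b₀ a₁ + δ a₁ b₁) ⊎ (Edge a₀ a₁ × Edge b₀ b₁)
  crossing {a₀} {b₀} {a₁} {b₁} a₀b₁ b₀a₁ =
    by-winding (s / p) (≈⇒≡+multiple (⟶-unique path (δ-reaches a₀ b₁)) (δ<p a₀ b₁))
      (m<n*o⇒m/o<n {s} {3} {p} s<3p)
    where
    X Y e f s : ℕ
    X = δ a₀ b₁
    Y = δ b₀ a₁
    e = δ a₀ b₀
    f = δ a₁ b₁
    s = e + (Y + f)
    path : a₀ ⟶[ s ] b₁
    path = ⟶-trans (δ-reaches a₀ b₀) (⟶-trans (δ-reaches b₀ a₁) (δ-reaches a₁ b₁))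
    s<3p : s < 3 * p
    s<3p = subst (s <_) (cong (λ r → p + (p + r)) (sym (+-identityʳ p)))
             (+-mono-< (δ<p a₀ b₀) (+-mono-< (δ<p b₀ a₁) (δ<p a₁ b₁)))
    mirror : ∀ a b c → a + (b + c) ≡ c + (b + a)
    mirror = solve-∀
    detours : s ≡ X ⊎ s ≡ X + 2 * p → Edge a₀ a₁ × Edge b₀ b₁
    detours sums =
      detour-edge (⟶-trans (δ-reaches a₀ b₀) (δ-reaches b₀ a₁))
        (δ<p a₀ b₀) (δ<p a₁ b₁) (edge⇒δ a₀b₁) (edge⇒δ b₀a₁) sums ,
      detour-edge (subst (b₀ ⟶[_] b₁) (+-comm Y f) (⟶-trans (δ-reaches b₀ a₁) (δ-reaches a₁ b₁)))
        (δ<p a₁ b₁) (δ<p a₀ b₀) (edge⇒δ a₀b₁) (edge⇒δ b₀a₁)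
        (Sum.map (trans (mirror f Y e)) (trans (mirror f Y e)) sums)
    by-winding : ∀ k → s ≡ X + k * p → k < 3 →
      X + p ≡ s ⊎ (Edge a₀ a₁ × Edge b₀ b₁)
    by-winding 0 s≡X _ = inj₂ (detours (inj₁ (trans s≡X (+-identityʳ X))))
    by-winding 1 s≡X+p _ = inj₁ (sym (trans s≡X+p (cong (X +_) (+-identityʳ p))))
    by-winding 2 s≡X+2p _ = inj₂ (detours (inj₂ s≡X+2p))
    by-winding (suc (suc (suc _))) _ (s≤s (s≤s (s≤s ())))

  windingFrom : Fin p → List (Fin p) → ℕ
  windingFrom x []       = 0
  windingFrom x (y ∷ ys) = δ x y + windingFrom y ys

  winding : List (Fin p) → ℕ
  winding []       = 0
  winding (x ∷ xs) = windingFrom x xs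

  windingFrom-++ : ∀ x xs ys →
    windingFrom x (xs ++ ys) ≡ windingFrom x xs + windingFrom (lastV x xs) ys
  windingFrom-++ x []       ys = refl
  windingFrom-++ x (y ∷ xs) ys =
    trans (cong (δ x y +_) (windingFrom-++ y xs ys)) (sym (+-assoc (δ x y) _ _))

  winding-cut : ∀ xs a zs → winding (xs ++ a ∷ zs) ≡ winding (xs ++ a ∷ []) + windingFrom a zs
  winding-cut []       a zs = refl
  winding-cut (x ∷ xs) a zs = cut x xs
    where
    cut : ∀ x xs → windingFrom x (xs ++ a ∷ zs) ≡ windingFrom x (xs ++ a ∷ []) + windingFrom a zs
    cut x []       = cong (_+ windingFrom a zs) (sym (+-identityʳ (δ x a)))
    cut x (y ∷ xs) = trans (cong (δ x y +_) (cut y xs)) (sym (+-assoc (δ x y) _ _))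

  record Balanced (W W' : List (Fin p)) : Set where
    constructor balanced
    field balance : 2 * winding W + p * length W' ≡ 2 * winding W' + p * length W

  balanced-sym : ∀ {W W'} → Balanced W W' → Balanced W' W
  balanced-sym (balanced b) = balanced (sym b)

  balanced-trans : ∀ {W₁ W₂ W₃} → Balanced W₁ W₂ → Balanced W₂ W₃ → Balanced W₁ W₃
  balanced-trans {W₁} {W₂} {W₃} (balanced b₁) (balanced b₂) = balanced
    (difference-trans {2 * winding W₁} {p * length W₁} {2 * winding W₂} {p * length W₂}
                      {2 * winding W₃} {p * length W₃} b₁ b₂)

  unchanged-balanced : ∀ {W W'} → winding W ≡ winding W' → length W ≡ length W' → Balanced W W'
  unchanged-balanced t l = balanced (cong₂ (λ w n → 2 * w + p * n) t (sym l))

  backtrack-balanced : ∀ {W W'} → winding W ≡ winding W' + p → length W ≡ 2 + length W' →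
    Balanced W W'
  backtrack-balanced {W} {W'} t l = balanced (begin
    2 * winding W + p * length W'         ≡⟨ cong (λ w → 2 * w + p * length W') t ⟩
    2 * (winding W' + p) + p * length W'  ≡⟨ shift p (winding W') (length W') ⟩
    2 * winding W' + p * (2 + length W')  ≡⟨ cong (λ n → 2 * winding W' + p * n) l ⟨
    2 * winding W' + p * length W         ∎)
    where
    open ≡-Reasoning
    shift : ∀ p w n → 2 * (w + p) + p * n ≡ 2 * w + p * (2 + n)
    shift = solve-∀

  move-balanced : ∀ {W W'} → Move (K p q) W W' → Balanced W W'
  move-balanced (cancel xs ys a b ab) = backtrack-balanced
    (begin
      winding (xs ++ a ∷ b ∷ a ∷ ys)              ≡⟨ winding-cut xs a (b ∷ a ∷ ys) ⟩
      P + (δ a b + (δ b a + windingFrom a ys))    ≡⟨ regroup P (δ a b) (δ b a) (windingFrom a ys) ⟩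
      P + windingFrom a ys + (δ a b + δ b a)      ≡⟨ cong₂ _+_ (sym (winding-cut xs a ys)) (there-and-back ab) ⟩
      winding (xs ++ a ∷ ys) + p                  ∎)
    (begin
      length (xs ++ a ∷ b ∷ a ∷ ys)               ≡⟨ length-++ xs ⟩
      length xs + (2 + length (a ∷ ys))           ≡⟨ +-exchange (length xs) 2 (length (a ∷ ys)) ⟩
      2 + (length xs + length (a ∷ ys))           ≡⟨ cong (2 +_) (length-++ xs) ⟨
      2 + length (xs ++ a ∷ ys)                   ∎)
    where
    open ≡-Reasoning
    P : ℕ
    P = winding (xs ++ a ∷ [])
    regroup : ∀ w x y z → w + (x + (y + z)) ≡ w + z + (x + y)
    regroup = solve-∀
    +-exchange : ∀ m n o → m + (n + o) ≡ n + (m + o)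
    +-exchange = solve-∀
  move-balanced (square xs ys v₁ v₂ v₃ v₄ sq) = unchanged-balanced
    (begin
      winding (xs ++ v₁ ∷ v₂ ∷ v₃ ∷ ys)              ≡⟨ winding-cut xs v₁ (v₂ ∷ v₃ ∷ ys) ⟩
      P + (δ v₁ v₂ + (δ v₂ v₃ + windingFrom v₃ ys))  ≡⟨ cong (P +_) (via-square (square-winding sq)) ⟩
      P + (δ v₁ v₄ + (δ v₄ v₃ + windingFrom v₃ ys))  ≡⟨ winding-cut xs v₁ (v₄ ∷ v₃ ∷ ys) ⟨
      winding (xs ++ v₁ ∷ v₄ ∷ v₃ ∷ ys)              ∎)
    (trans (length-++ xs) (sym (length-++ xs)))
    where
    open ≡-Reasoning
    P : ℕ
    P = winding (xs ++ v₁ ∷ [])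
    via-square : δ v₁ v₂ + δ v₂ v₃ ≡ δ v₁ v₄ + δ v₄ v₃ →
      δ v₁ v₂ + (δ v₂ v₃ + windingFrom v₃ ys) ≡ δ v₁ v₄ + (δ v₄ v₃ + windingFrom v₃ ys)
    via-square eq = trans (sym (+-assoc (δ v₁ v₂) _ _))
      (trans (cong (_+ windingFrom v₃ ys) eq) (+-assoc (δ v₁ v₄) _ _))

  ∼-balanced : ∀ {W W'} → WalkEquiv (K p q) W W' → Balanced W W'
  ∼-balanced ε            = balanced refl
  ∼-balanced (fwd m ◅ ms) = balanced-trans (move-balanced m) (∼-balanced ms)
  ∼-balanced (bwd m ◅ ms) = balanced-trans (balanced-sym (move-balanced m)) (∼-balanced ms)

  -- The ladder over a walk of G: the images under μ of the two zigzag walks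
  -- (x,h₀)(y₁,h₁)(y₂,h₀)… and (x,h₁)(y₁,h₀)(y₂,h₁)… (the rails), joined at every
  -- vertex x of G by the rung μ(x,h₀)μ(x,h₁).
  module Ladder (G H : Graph) (μ : Hom (G ⊗ H) (K p q))
                (h₀ h₁ : V H) (h₀h₁ : E H h₀ h₁) (h₁h₀ : E H h₁ h₀) where

    μ₀ : V G × V H → Fin p
    μ₀ = proj₁ μ

    rail : V H × V H → V G → List (V G) → ℕ
    rail (h , h') x ys = windingFrom (μ₀ (x , h)) (map μ₀ (altZip ys h' h))

    rail-++ : ∀ hh x ys zs →
      rail hh x (ys ++ zs) ≡ rail hh x ys + rail (flipAlong ys hh) (lastV x ys) zs
    rail-++ hh       x []       zs = refl
    rail-++ (h , h') x (y ∷ ys) zs =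
      trans (cong (δ (μ₀ (x , h)) (μ₀ (y , h')) +_) (rail-++ (h' , h) y ys zs))
            (sym (+-assoc (δ (μ₀ (x , h)) (μ₀ (y , h'))) _ _))

    rung : V G → ℕ
    rung x = δ (μ₀ (x , h₀)) (μ₀ (x , h₁))

    GoodStep : V G → V G → Set
    GoodStep x y = Edge (μ₀ (x , h₀)) (μ₀ (y , h₀)) × Edge (μ₀ (x , h₁)) (μ₀ (y , h₁))

    good? : ∀ x y → Dec (GoodStep x y)
    good? x y = edge? _ _ ×-dec edge? _ _

    HasGoodStep : V G → List (V G) → Set
    HasGoodStep x ys = ∃[ a ] ∃[ b ] (IsStepOf a b (x ∷ ys) × GoodStep a b)

    data BadWalk : V G → List (V G) → Set where
      stop : ∀ {x} → BadWalk x []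
      step : ∀ {x y ys} → E G x y → ¬ GoodStep x y → BadWalk y ys → BadWalk x (y ∷ ys)

    good-or-bad : ∀ {x ys} → IsWalk G x ys → HasGoodStep x ys ⊎ BadWalk x ys
    good-or-bad nil = inj₂ stop
    good-or-bad {x} {y ∷ ys} (cons xy walk) with good? x y
    ... | yes good = inj₁ (x , y , ([] , ys , refl) , good)
    ... | no bad   = Sum.map later (step xy bad) (good-or-bad walk)
      where
      later : HasGoodStep y ys → HasGoodStep x (y ∷ ys)
      later (a , b , (us , vs , eq) , good) = a , b , (x ∷ us , vs , cong (x ∷_) eq) , good

    -- Along a bad walk crossing applies at every step; summing it shows that the windings
    -- of the two rails plus length·p plus the two end rungs add up to an even number.
    ladder-even : ∀ {x ys} → BadWalk x ys →
      ∃[ S ] rail (h₀ , h₁) x ys + rail (h₁ , h₀) x ys + length ys * p + rung x + rung (lastV x ys)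
               ≡ 2 * S
    ladder-even {x} stop = rung x , cong (rung x +_) (sym (+-identityʳ (rung x)))
    ladder-even {x} (step {y = y} {ys} xy bad rest)
      with crossing (proj₂ μ (xy , h₀h₁)) (proj₂ μ (xy , h₁h₀)) | ladder-even rest
    ... | inj₂ good        | _          = ⊥-elim (bad good)
    ... | inj₁ winds-once  | (S , even) = rung x + Y + S , (begin
      X + R₁ + (Y + R₀) + suc N * p + rung x + l
        ≡⟨ regroup₁ X R₁ Y R₀ N p (rung x) l ⟩
      (X + p) + (Y + rung x) + (R₀ + R₁ + N * p + l)
        ≡⟨ cong (λ t → t + (Y + rung x) + (R₀ + R₁ + N * p + l)) winds-once ⟩
      rung x + (Y + rung y) + (Y + rung x) + (R₀ + R₁ + N * p + l)
        ≡⟨ regroup₂ (rung x) Y (rung y) R₀ R₁ (N * p) l ⟩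
      2 * (rung x + Y) + (R₀ + R₁ + N * p + rung y + l)
        ≡⟨ cong (2 * (rung x + Y) +_) even ⟩
      2 * (rung x + Y) + 2 * S
        ≡⟨ *-distribˡ-+ 2 (rung x + Y) S ⟨
      2 * (rung x + Y + S) ∎)
      where
      open ≡-Reasoning
      X Y R₀ R₁ N l : ℕ
      X  = δ (μ₀ (x , h₀)) (μ₀ (y , h₁))
      Y  = δ (μ₀ (x , h₁)) (μ₀ (y , h₀))
      R₀ = rail (h₀ , h₁) y ys
      R₁ = rail (h₁ , h₀) y ys
      N  = length ys
      l  = rung (lastV y ys)
      regroup₁ : ∀ X R₁ Y R₀ N p e l →
        X + R₁ + (Y + R₀) + suc N * p + e + l ≡ (X + p) + (Y + e) + (R₀ + R₁ + N * p + l)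
      regroup₁ = solve-∀
      regroup₂ : ∀ e Y f R₀ R₁ Np l →
        e + (Y + f) + (Y + e) + (R₀ + R₁ + Np + l) ≡ 2 * (e + Y) + (R₀ + R₁ + Np + f + l)
      regroup₂ = solve-∀

    bad-walk-even-half-parity : ∀ {g cs} → Odd p → BadWalk g cs → lastV g cs ≡ g →
      Odd (length cs) → ¬ OddHalfParity G H p q μ h₀ h₁ g cs
    bad-walk-even-half-parity {g} {cs} odd-p bad closed (k , |cs|≡)
                              (w , ws , (_ , ws-closed) , odd-ws , equiv) =
      parity-clash {p} {length ws} {winding W} {length cs} {rung g} {windingFrom w ws}
        odd-p odd-ws rails-even
        (halve-balance {p} {winding W} {windingFrom w ws + windingFrom w ws} two-balanced)
      where
      W : List (Fin p)
      W = map μ₀ (prodWalk G H g cs h₀ h₁)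
      -- μ(C × h₀h₁) runs along one rail over C and comes back along the other
      both-rails : winding W ≡ rail (h₀ , h₁) g cs + rail (h₁ , h₀) g cs
      both-rails = trans (rail-++ (h₀ , h₁) g cs cs)
        (cong₂ (λ hh x → rail (h₀ , h₁) g cs + rail hh x cs)
               (flipAlong-odd cs (h₀ , h₁) {k} |cs|≡) closed)
      rails-even : ∃[ S ] winding W + length cs * p + rung g + rung g ≡ 2 * S
      rails-even with ladder-even bad
      ... | S , even =
        S , trans (cong₂ (λ t x → t + length cs * p + rung g + rung x) both-rails (sym closed)) even
      length-W : length W ≡ suc (length cs + length cs)
      length-W = trans (length-map μ₀ (prodWalk G H g cs h₀ h₁))
        (cong suc (trans (length-altZip (cs ++ cs) h₁ h₀) (length-++ cs)))
      winding-WW : winding (w ∷ ws ++ ws) ≡ windingFrom w ws + windingFrom w ws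
      winding-WW = trans (windingFrom-++ w ws ws)
        (cong (λ x → windingFrom w ws + windingFrom x ws) ws-closed)
      two-balanced : 2 * winding W + p * suc (length ws + length ws)
                   ≡ 2 * (windingFrom w ws + windingFrom w ws) + p * suc (length cs + length cs)
      two-balanced = begin
        2 * winding W + p * suc (length ws + length ws)
          ≡⟨ cong (λ n → 2 * winding W + p * suc n) (length-++ ws) ⟨
        2 * winding W + p * length (w ∷ ws ++ ws)
          ≡⟨ Balanced.balance (∼-balanced equiv) ⟩
        2 * winding (w ∷ ws ++ ws) + p * length W
          ≡⟨ cong₂ (λ t n → 2 * t + p * n) winding-WW length-W ⟩
        2 * (windingFrom w ws + windingFrom w ws) + p * suc (length cs + length cs) ∎
        where open ≡-Reasoning

corollary11 : (p q : ℕ) → 2 * q < p → p < 4 * q → Odd p →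
    (G H : Graph) → IsFiniteSimpleGraph G → IsFiniteSimpleGraph H →
    (μ : Hom (G ⊗ H) (K p q)) →
    (h₀ h₁ : V H) → E H h₀ h₁ →
    (g : V G) (cs : List (V G)) → IsClosedWalk G g cs → Odd (length cs) →
    OddHalfParity G H p q μ h₀ h₁ g cs →
    ∃[ x ] ∃[ x' ] (IsStepOf x x' (g ∷ cs) ×
      E (K p q) (proj₁ μ (x , h₀)) (proj₁ μ (x' , h₀)) ×
      E (K p q) (proj₁ μ (x , h₁)) (proj₁ μ (x' , h₁)))
corollary11 p q 2q<p p<4q odd-p G H _ (_ , symmetric-H , _) μ h₀ h₁ h₀h₁ g cs (walk , closed)
            odd-C half-parity =
  Sum.fromInj₁ (λ bad → ⊥-elim (bad-walk-even-half-parity odd-p bad closed odd-C half-parity))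
               (good-or-bad walk)
  where
  open Circular p q 2q<p p<4q
  open Ladder G H μ h₀ h₁ h₀h₁ (symmetric-H h₀h₁)
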